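{- For every integer $k>0$, with $n=8k+2$, we have $\mathsf{D}_{\oplus}(\mathrm{THR}_n^3)=n-1$.
   Context: $\mathrm{THR}_n^3\colon\{0,1\}^n\to\{ -1,1\}$ is defined by $\mathrm{THR}_n^3(x)=-1$ iff $\sum_{i=1}^n x_i\ge 3$. A parity decision tree is a rooted binary tree whose internal nodes are labeled by parities $\bigoplus_{i\in S}x_i$, with two outgoing edges labeled by the possible parity values, and leaves labeled by $-1$ or $1$; $\mathsf{D}_{\oplus}(f)$ is the minimal depth of a parity decision tree computing $f$. -}

module Defs where

open import Data.Nat using (ℕ; zero; suc; _+_; _⊔_; _≤_; _≥_; _≤ᵇ_)
open import Data.Bool using (Bool; true; false; _xor_; _∧_; if_then_else_)
open import Data.Fin using (Fin)
open import Data.Vec using (Vec; []; _∷_; lookup; zipWith; foldr)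
open import Data.Product using (Σ; _×_)
open import Relation.Binary.PropositionalEquality using (_≡_)

data Sign : Set where
  -1ₛ +1ₛ : Sign

-- inputs x ∈ {0,1}^n, encoded as Bool (true = 1)
Input : ℕ → Set
Input n = Vec Bool n

weight : ∀ {n} → Input n → ℕ
weight [] = 0
weight (true ∷ xs) = suc (weight xs)
weight (false ∷ xs) = weight xs

THR3 : (n : ℕ) → Input n → Sign
THR3 n x = if 3 ≤ᵇ weight x then -1ₛ else +1ₛ

-- parity ⊕_{i ∈ S} x_i, with S ⊆ [n] given by its characteristic vector
parity : ∀ {n} → Vec Bool n → Input n → Bool
parity S x = foldr _ _xor_ false (zipWith _∧_ S x)

-- parity decision trees over n variables
-- node S t₀ t₁ queries ⊕_{i∈S} x_i and goes to t₀ on value 0, t₁ on value 1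
data PDT (n : ℕ) : Set where
  leaf : Sign → PDT n
  node : Vec Bool n → PDT n → PDT n → PDT n

depth : ∀ {n} → PDT n → ℕ
depth (leaf _) = 0
depth (node _ t₀ t₁) = suc (depth t₀ ⊔ depth t₁)

eval : ∀ {n} → PDT n → Input n → Sign
eval (leaf b) x = b
eval (node S t₀ t₁) x = if parity S x then eval t₁ x else eval t₀ x

Computes : ∀ {n} → PDT n → (Input n → Sign) → Set
Computes t f = ∀ x → eval t x ≡ f x

ParityDTDepthIs : ∀ {n} → (Input n → Sign) → ℕ → Set
ParityDTDepthIs {n} f d =
  Σ (PDT n) (λ t → Computes t f × depth t ≡ d)
  × (∀ (t : PDT n) → Computes t f → d ≤ depth t)

-- Upper bound: while x₁ ⊕ x₂, x₃ ⊕ x₄, x₁ ⊕ x₃ and x₁ all vanish, the first four bits are 0 and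
-- we recurse on the others; any other answer determines the weight of those four bits after at
-- most three queries, and the rest of the input is read off bit by bit. Starting from THR³₂ ≡ 1,
-- this gives depth n − 1 for every n ≡ 2 (mod 4).
--
-- Lower bound: let coeff f U = Σₓ [f x = 1] χ_U(x), which is 2ⁿ times a Fourier coefficient of
-- the indicator of f⁻¹(1). In a parity tree of depth d every such coefficient is divisible by
-- 2ⁿ⁻ᵈ, because a query S writes twice a coefficient at U through coefficients of the two
-- subtrees at U and U ⊕ S. If a tree of depth ≤ n − 2 computed THR³ₙ and queried S ≠ 0 first,
-- its 0-subtree has depth ≤ n − 3 and agrees with THR³ₙ where ⊕_S x = 0, so 8 divides
-- coeff THR³ T + coeff THR³ (T ⊕ S) for every T. For n = 8K + 2 the closed form of these
-- coefficients makes this sum ≡ 4 (mod 8) whenever w(w+1) + w′(w′+1) ≡ 2 (mod 4) for w = |T|,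
-- w′ = |T ⊕ S|, and such a T exists for every S ≠ 0.

module Submission where

open import Defs
open import Data.Bool using (Bool; true; false; _xor_; _∧_; if_then_else_; not)
open import Data.Bool.Properties
  using (T-≡; ∧-zeroʳ; ∧-identityʳ; not-distribʳ-xor; xor-annihilates-not; xor-assoc)
open import Data.Empty using (⊥-elim)
open import Data.Integer using (ℤ; +_; -1ℤ; _+_; _-_; _*_; -_; _^_)
import Data.Integer.Properties as ℤ
open import Data.Integer.Divisibility.Signed
  using (_∣_; divides; ∣-refl; ∣-trans; ∣m∣n⇒∣m+n; ∣m∣n⇒∣m-n; ∣m⇒∣m*n; *-monoʳ-∣; *-cancelˡ-∣; ∣⇒∣ᵤ)
open import Data.Integer.Tactic.RingSolver using (solve-∀)
open import Data.Nat as ℕ using (ℕ; zero; suc; _≤_; _<_; _≤ᵇ_; z≤n; s≤s)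
import Data.Nat.Properties as ℕ
open import Data.Nat.DivMod
  using (_%_; _/_; m≡m%n+[m/n]*n; [m+kn]%n≡m%n; %-distribˡ-+; %-remove-+ˡ; m%n<n)
open import Data.Nat.Divisibility using (n∣m*n; n∣m⇒m%n≡0) renaming (_∣_ to _∣ℕ_)
import Data.Nat.Tactic.RingSolver as ℕ-Solver
open import Data.Product using (∃-syntax; _×_; _,_)
open import Data.Sum using (inj₁; inj₂)
open import Data.Vec using (Vec; []; _∷_; _++_; replicate; zipWith)
open import Function using (_∘_; Equivalence)
open import Relation.Nullary using (¬_; yes; no)
open import Relation.Binary.PropositionalEquality
open ≡-Reasoning

zeros : ∀ n → Vec Bool n
zeros n = replicate n false

_⊕_ : ∀ {n} → Vec Bool n → Vec Bool n → Vec Bool n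
_⊕_ = zipWith _xor_

⊕-identityˡ : ∀ {n} (S : Vec Bool n) → zeros n ⊕ S ≡ S
⊕-identityˡ []      = refl
⊕-identityˡ (s ∷ S) = cong (s ∷_) (⊕-identityˡ S)

weight-zeros : ∀ n → weight (zeros n) ≡ 0
weight-zeros zero    = refl
weight-zeros (suc n) = weight-zeros n

weight-ones : ∀ n → weight (replicate n true) ≡ n
weight-ones zero    = refl
weight-ones (suc n) = cong suc (weight-ones n)

weight-≤ : ∀ {n} (S : Vec Bool n) → weight S ≤ n
weight-≤ []          = z≤n
weight-≤ (true ∷ S)  = s≤s (weight-≤ S)
weight-≤ (false ∷ S) = ℕ.m≤n⇒m≤1+n (weight-≤ S)

weight≡0⇒zeros : ∀ {n} (S : Vec Bool n) → weight S ≡ 0 → S ≡ zeros n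
weight≡0⇒zeros []          _  = refl
weight≡0⇒zeros (false ∷ S) eq = cong (false ∷_) (weight≡0⇒zeros S eq)

xor-∧-interchange : ∀ u s b p q → ((u xor s) ∧ b) xor (p xor q) ≡ ((u ∧ b) xor p) xor ((s ∧ b) xor q)
xor-∧-interchange false false b     p q = refl
xor-∧-interchange false true  false p q = refl
xor-∧-interchange false true  true  p q = not-distribʳ-xor p q
xor-∧-interchange true  false b     p q = sym (xor-assoc b p q)
xor-∧-interchange true  true  false p q = refl
xor-∧-interchange true  true  true  p q = sym (xor-annihilates-not p q)

parity-⊕ : ∀ {n} (U S x : Vec Bool n) → parity (U ⊕ S) x ≡ parity U x xor parity S x
parity-⊕ []      []      []      = refl
parity-⊕ (u ∷ U) (s ∷ S) (b ∷ x) rewrite parity-⊕ U S x = xor-∧-interchange u s b (parity U x) (parity S x)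

parity-zeros : ∀ {n} (x : Vec Bool n) → parity (zeros n) x ≡ false
parity-zeros []      = refl
parity-zeros (b ∷ x) = parity-zeros x

sgn : Bool → ℤ
sgn false = + 1
sgn true  = -1ℤ

sgn-xor : ∀ a b → sgn (a xor b) ≡ sgn a * sgn b
sgn-xor false false = refl
sgn-xor false true  = refl
sgn-xor true  false = refl
sgn-xor true  true  = refl

sgn-not : ∀ a → sgn (not a) ≡ - sgn a
sgn-not false = refl
sgn-not true  = refl

χ : ∀ {n} → Vec Bool n → Input n → ℤ
χ U x = sgn (parity U x)

χ-⊕ : ∀ {n} (U S x : Vec Bool n) → χ (U ⊕ S) x ≡ χ U x * χ S x
χ-⊕ U S x = trans (cong sgn (parity-⊕ U S x)) (sgn-xor (parity U x) (parity S x))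

χ-∷ : ∀ {n} u b (U x : Vec Bool n) → χ (u ∷ U) (b ∷ x) ≡ sgn (u ∧ b) * χ U x
χ-∷ u b U x = sgn-xor (u ∧ b) (parity U x)

cubeSum : ∀ n → (Input n → ℤ) → ℤ
cubeSum zero    f = f []
cubeSum (suc n) f = cubeSum n (λ x → f (false ∷ x)) + cubeSum n (λ x → f (true ∷ x))

cubeSum-cong : ∀ n {f g : Input n → ℤ} → (∀ x → f x ≡ g x) → cubeSum n f ≡ cubeSum n g
cubeSum-cong zero    f≗g = f≗g []
cubeSum-cong (suc n) f≗g = cong₂ _+_ (cubeSum-cong n (λ x → f≗g (false ∷ x))) (cubeSum-cong n (λ x → f≗g (true ∷ x)))

cubeSum-zero : ∀ n → cubeSum n (λ _ → + 0) ≡ + 0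
cubeSum-zero zero    = refl
cubeSum-zero (suc n) = cong₂ _+_ (cubeSum-zero n) (cubeSum-zero n)

cubeSum-+ : ∀ n (f g : Input n → ℤ) → cubeSum n (λ x → f x + g x) ≡ cubeSum n f + cubeSum n g
cubeSum-+ zero    f g = refl
cubeSum-+ (suc n) f g = begin
  cubeSum n (λ x → f (false ∷ x) + g (false ∷ x)) + cubeSum n (λ x → f (true ∷ x) + g (true ∷ x))
    ≡⟨ cong₂ _+_ (cubeSum-+ n _ _) (cubeSum-+ n _ _) ⟩
  (f₀ + g₀) + (f₁ + g₁)
    ≡⟨ interchange f₀ g₀ f₁ g₁ ⟩
  (f₀ + f₁) + (g₀ + g₁) ∎
  where
  f₀ = cubeSum n (λ x → f (false ∷ x))
  f₁ = cubeSum n (λ x → f (true ∷ x))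
  g₀ = cubeSum n (λ x → g (false ∷ x))
  g₁ = cubeSum n (λ x → g (true ∷ x))
  interchange : ∀ a b c d → (a + b) + (c + d) ≡ (a + c) + (b + d)
  interchange = solve-∀

cubeSum-*ˡ : ∀ n c (f : Input n → ℤ) → cubeSum n (λ x → c * f x) ≡ c * cubeSum n f
cubeSum-*ˡ zero    c f = refl
cubeSum-*ˡ (suc n) c f = trans (cong₂ _+_ (cubeSum-*ˡ n c _) (cubeSum-*ˡ n c _))
  (sym (ℤ.*-distribˡ-+ c (cubeSum n (λ x → f (false ∷ x))) (cubeSum n (λ x → f (true ∷ x)))))

cubeSum-neg : ∀ n (f : Input n → ℤ) → cubeSum n (λ x → - f x) ≡ - cubeSum n f
cubeSum-neg n f = begin
  cubeSum n (λ x → - f x)     ≡⟨ cubeSum-cong n (λ x → sym (ℤ.-1*i≡-i (f x))) ⟩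
  cubeSum n (λ x → -1ℤ * f x) ≡⟨ cubeSum-*ˡ n -1ℤ f ⟩
  -1ℤ * cubeSum n f           ≡⟨ ℤ.-1*i≡-i (cubeSum n f) ⟩
  - cubeSum n f               ∎

cubeSum-∣ : ∀ n {d} {f : Input n → ℤ} → (∀ x → d ∣ f x) → d ∣ cubeSum n f
cubeSum-∣ zero    d∣f = d∣f []
cubeSum-∣ (suc n) d∣f = ∣m∣n⇒∣m+n (cubeSum-∣ n (λ x → d∣f (false ∷ x))) (cubeSum-∣ n (λ x → d∣f (true ∷ x)))

pow2-∣-cubeSum-χ : ∀ {n} (U : Vec Bool n) → (+ 2) ^ n ∣ cubeSum n (χ U)
pow2-∣-cubeSum-χ [] = ∣-refl
pow2-∣-cubeSum-χ {suc n} (false ∷ U) =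
  subst ((+ 2) ^ suc n ∣_) (double (cubeSum n (χ U))) (*-monoʳ-∣ (+ 2) (pow2-∣-cubeSum-χ U))
  where
  double : ∀ a → + 2 * a ≡ a + a
  double = solve-∀
pow2-∣-cubeSum-χ {suc n} (true ∷ U) = subst ((+ 2) ^ suc n ∣_) (sym cancel) (divides (+ 0) refl)
  where
  cancel : cubeSum n (χ U) + cubeSum n (λ x → sgn (not (parity U x))) ≡ + 0
  cancel = begin
    cubeSum n (χ U) + cubeSum n (λ x → sgn (not (parity U x)))
      ≡⟨ cong (λ s → cubeSum n (χ U) + s) (trans (cubeSum-cong n (λ x → sgn-not (parity U x))) (cubeSum-neg n (χ U))) ⟩
    cubeSum n (χ U) - cubeSum n (χ U)
      ≡⟨ ℤ.+-inverseʳ (cubeSum n (χ U)) ⟩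
    + 0 ∎

-- Granularity of parity decision trees

𝟙⁺ : Sign → ℤ
𝟙⁺ -1ₛ = + 0
𝟙⁺ +1ₛ = + 1

coeff : ∀ {n} → (Input n → Sign) → Vec Bool n → ℤ
coeff {n} f U = cubeSum n (λ x → 𝟙⁺ (f x) * χ U x)

coeff-select : ∀ {n} (S : Vec Bool n) (f g : Input n → Sign) U →
  + 2 * coeff (λ x → if parity S x then g x else f x) U
    ≡ (coeff f U + coeff f (U ⊕ S)) + (coeff g U - coeff g (U ⊕ S))
coeff-select {n} S f g U = begin
  + 2 * coeff h U
    ≡⟨ cubeSum-*ˡ n (+ 2) _ ⟨
  cubeSum n (λ x → + 2 * (𝟙⁺ (h x) * χ U x))
    ≡⟨ cubeSum-cong n pointwise ⟩
  cubeSum n (λ x → (F x + F′ x) + (G x - G′ x))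
    ≡⟨ cubeSum-+ n _ _ ⟩
  cubeSum n (λ x → F x + F′ x) + cubeSum n (λ x → G x - G′ x)
    ≡⟨ cong₂ _+_ (cubeSum-+ n F F′) (trans (cubeSum-+ n G (λ x → - G′ x)) (cong (λ s → coeff g U + s) (cubeSum-neg n G′))) ⟩
  (coeff f U + coeff f (U ⊕ S)) + (coeff g U - coeff g (U ⊕ S)) ∎
  where
  h : Input n → Sign
  h x = if parity S x then g x else f x
  F F′ G G′ : Input n → ℤ
  F  x = 𝟙⁺ (f x) * χ U x
  F′ x = 𝟙⁺ (f x) * χ (U ⊕ S) x
  G  x = 𝟙⁺ (g x) * χ U x
  G′ x = 𝟙⁺ (g x) * χ (U ⊕ S) x
  even-case : ∀ a b c → + 2 * (a * c) ≡ (a * c + a * (c * + 1)) + (b * c - b * (c * + 1))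
  even-case = solve-∀
  odd-case : ∀ a b c → + 2 * (b * c) ≡ (a * c + a * (c * -1ℤ)) + (b * c - b * (c * -1ℤ))
  odd-case = solve-∀
  pointwise : ∀ x → + 2 * (𝟙⁺ (h x) * χ U x) ≡ (F x + F′ x) + (G x - G′ x)
  pointwise x rewrite χ-⊕ U S x with parity S x
  ... | false = even-case (𝟙⁺ (f x)) (𝟙⁺ (g x)) (χ U x)
  ... | true  = odd-case (𝟙⁺ (f x)) (𝟙⁺ (g x)) (χ U x)

coeff-pair-cong : ∀ {n} (S : Vec Bool n) {f g : Input n → Sign} →
  (∀ x → parity S x ≡ false → f x ≡ g x) →
  ∀ U → coeff f U + coeff f (U ⊕ S) ≡ coeff g U + coeff g (U ⊕ S)
coeff-pair-cong {n} S {f} {g} f≗g U = begin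
  coeff f U + coeff f (U ⊕ S)           ≡⟨ cubeSum-+ n _ _ ⟨
  cubeSum n (λ x → pair f x)            ≡⟨ cubeSum-cong n pointwise ⟩
  cubeSum n (λ x → pair g x)            ≡⟨ cubeSum-+ n _ _ ⟩
  coeff g U + coeff g (U ⊕ S)           ∎
  where
  pair : (Input n → Sign) → Input n → ℤ
  pair k x = 𝟙⁺ (k x) * χ U x + 𝟙⁺ (k x) * χ (U ⊕ S) x
  cancels : ∀ a c → a * c + a * (c * -1ℤ) ≡ + 0
  cancels = solve-∀
  pointwise : ∀ x → pair f x ≡ pair g x
  pointwise x rewrite χ-⊕ U S x with parity S x in eq
  ... | false = cong (λ e → 𝟙⁺ e * χ U x + 𝟙⁺ e * (χ U x * + 1)) (f≗g x eq)
  ... | true  = trans (cancels (𝟙⁺ (f x)) (χ U x)) (sym (cancels (𝟙⁺ (g x)) (χ U x)))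

^-∣-^ : ∀ i {e n} → e ≤ n → i ^ e ∣ i ^ n
^-∣-^ i {e} {n} e≤n = subst (λ k → i ^ e ∣ i ^ k) (ℕ.m+[n∸m]≡n e≤n)
  (subst (i ^ e ∣_) (sym (ℤ.^-distribˡ-+-* i e (n ℕ.∸ e))) (∣m⇒∣m*n (i ^ (n ℕ.∸ e)) ∣-refl))

subtree-depth : ∀ {d d′ e n} → d ≤ d′ → suc d′ ℕ.+ e ≤ n → d ℕ.+ suc e ≤ n
subtree-depth {d} {d′} {e} d≤d′ h = ℕ.≤-trans (ℕ.≤-reflexive (ℕ.+-suc d e)) (ℕ.≤-trans (s≤s (ℕ.+-monoˡ-≤ e d≤d′)) h)

granularity : ∀ {n e} (t : PDT n) → depth t ℕ.+ e ≤ n → ∀ U → (+ 2) ^ e ∣ coeff (eval t) U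
granularity {n} (leaf -1ₛ) _ U = cubeSum-∣ n (λ _ → divides (+ 0) refl)
granularity {n} {e} (leaf +1ₛ) e≤n U =
  subst ((+ 2) ^ e ∣_) (cubeSum-cong n (λ x → sym (ℤ.*-identityˡ (χ U x))))
        (∣-trans (^-∣-^ (+ 2) e≤n) (pow2-∣-cubeSum-χ U))
granularity {n} {e} (node S t₀ t₁) h U = *-cancelˡ-∣ (+ 2) (subst ((+ 2) ^ suc e ∣_) (sym (coeff-select S (eval t₀) (eval t₁) U))
  (∣m∣n⇒∣m+n (∣m∣n⇒∣m+n (granularity t₀ h₀ U) (granularity t₀ h₀ (U ⊕ S)))
             (∣m∣n⇒∣m-n (granularity t₁ h₁ U) (granularity t₁ h₁ (U ⊕ S)))))
  where
  h₀ = subtree-depth (ℕ.m≤m⊔n (depth t₀) (depth t₁)) h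
  h₁ = subtree-depth (ℕ.m≤n⊔m (depth t₀) (depth t₁)) h

-- Coefficients of threshold functions

THR : ∀ {n} → ℕ → Input n → Sign
THR j x = if j ≤ᵇ weight x then -1ₛ else +1ₛ

THR-suc-true : ∀ {n} j (x : Input n) → THR (suc j) (true ∷ x) ≡ THR j x
THR-suc-true zero    x = refl
THR-suc-true (suc j) x = refl

coeff-THR-suc : ∀ {n} j u (U : Vec Bool n) →
  coeff (THR (suc j)) (u ∷ U) ≡ coeff (THR (suc j)) U + sgn u * coeff (THR j) U
coeff-THR-suc {n} j u U = cong₂ _+_
  (cubeSum-cong n first)
  (trans (cubeSum-cong n second) (cubeSum-*ˡ n (sgn u) _))
  where
  swap : ∀ a s c → a * (s * c) ≡ s * (a * c)
  swap = solve-∀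
  first : ∀ x → 𝟙⁺ (THR (suc j) x) * χ (u ∷ U) (false ∷ x) ≡ 𝟙⁺ (THR (suc j) x) * χ U x
  first x rewrite χ-∷ u false U x | ∧-zeroʳ u = cong (𝟙⁺ (THR (suc j) x) *_) (ℤ.*-identityˡ (χ U x))
  second : ∀ x → 𝟙⁺ (THR (suc j) (true ∷ x)) * χ (u ∷ U) (true ∷ x) ≡ sgn u * (𝟙⁺ (THR j x) * χ U x)
  second x rewrite χ-∷ u true U x | ∧-identityʳ u | THR-suc-true j x = swap (𝟙⁺ (THR j x)) (sgn u) (χ U x)

coeff-THR1 : ∀ {n} (U : Vec Bool n) → coeff (THR 1) U ≡ + 1
coeff-THR1 [] = refl
coeff-THR1 {suc n} (u ∷ U) = begin
  coeff (THR 1) (u ∷ U)                   ≡⟨ coeff-THR-suc 0 u U ⟩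
  coeff (THR 1) U + sgn u * coeff (THR 0) U ≡⟨ cong₂ (λ a b → a + sgn u * b) (coeff-THR1 U) (cubeSum-zero n) ⟩
  + 1 + sgn u * + 0                       ≡⟨ cong (λ c → + 1 + c) (ℤ.*-zeroʳ (sgn u)) ⟩
  + 1                                     ∎

bias : ∀ {n} → Vec Bool n → ℤ
bias {n} U = + n - + 2 * + weight U

bias-∷ : ∀ {n} u (U : Vec Bool n) → bias (u ∷ U) ≡ sgn u + bias U
bias-∷ {n} false U = shift (+ n) (+ weight U)
  where
  shift : ∀ n w → (+ 1 + n) - + 2 * w ≡ + 1 + (n - + 2 * w)
  shift = solve-∀
bias-∷ {n} true U = shift (+ n) (+ weight U)
  where
  shift : ∀ n w → (+ 1 + n) - + 2 * (+ 1 + w) ≡ -1ℤ + (n - + 2 * w)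
  shift = solve-∀

coeff-THR2 : ∀ {n} (U : Vec Bool n) → coeff (THR 2) U ≡ + 1 + bias U
coeff-THR2 [] = refl
coeff-THR2 {suc n} (u ∷ U) = begin
  coeff (THR 2) (u ∷ U)                     ≡⟨ coeff-THR-suc 1 u U ⟩
  coeff (THR 2) U + sgn u * coeff (THR 1) U ≡⟨ cong₂ (λ a b → a + sgn u * b) (coeff-THR2 U) (coeff-THR1 U) ⟩
  + 1 + bias U + sgn u * + 1                ≡⟨ rearrange (sgn u) (bias U) ⟩
  + 1 + (sgn u + bias U)                    ≡⟨ cong (λ b → + 1 + b) (bias-∷ u U) ⟨
  + 1 + bias (u ∷ U)                        ∎
  where
  rearrange : ∀ s b → + 1 + b + s * + 1 ≡ + 1 + (s + b)
  rearrange = solve-∀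

twice-coeff-THR3 : ∀ {n} (U : Vec Bool n) → + 2 * coeff (THR 3) U ≡ (+ 1 + bias U) * (+ 1 + bias U) + + 1 - + n
twice-coeff-THR3 [] = refl
twice-coeff-THR3 {suc n} (u ∷ U) = begin
  + 2 * coeff (THR 3) (u ∷ U)
    ≡⟨ cong (+ 2 *_) (coeff-THR-suc 2 u U) ⟩
  + 2 * (coeff (THR 3) U + sgn u * coeff (THR 2) U)
    ≡⟨ ℤ.*-distribˡ-+ (+ 2) (coeff (THR 3) U) _ ⟩
  + 2 * coeff (THR 3) U + + 2 * (sgn u * coeff (THR 2) U)
    ≡⟨ cong₂ (λ a b → a + + 2 * (sgn u * b)) (twice-coeff-THR3 U) (coeff-THR2 U) ⟩
  ((+ 1 + bias U) * (+ 1 + bias U) + + 1 - + n) + + 2 * (sgn u * (+ 1 + bias U))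
    ≡⟨ square-step u (bias U) (+ n) ⟩
  (+ 1 + (sgn u + bias U)) * (+ 1 + (sgn u + bias U)) + + 1 - + suc n
    ≡⟨ cong (λ b → (+ 1 + b) * (+ 1 + b) + + 1 - + suc n) (bias-∷ u U) ⟨
  (+ 1 + bias (u ∷ U)) * (+ 1 + bias (u ∷ U)) + + 1 - + suc n ∎
  where
  step₊ : ∀ b n → ((+ 1 + b) * (+ 1 + b) + + 1 - n) + + 2 * (+ 1 * (+ 1 + b))
                ≡ (+ 1 + (+ 1 + b)) * (+ 1 + (+ 1 + b)) + + 1 - (+ 1 + n)
  step₊ = solve-∀
  step₋ : ∀ b n → ((+ 1 + b) * (+ 1 + b) + + 1 - n) + + 2 * (-1ℤ * (+ 1 + b))
                ≡ (+ 1 + (-1ℤ + b)) * (+ 1 + (-1ℤ + b)) + + 1 - (+ 1 + n)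
  step₋ = solve-∀
  square-step : ∀ u b n → ((+ 1 + b) * (+ 1 + b) + + 1 - n) + + 2 * (sgn u * (+ 1 + b))
                        ≡ (+ 1 + (sgn u + b)) * (+ 1 + (sgn u + b)) + + 1 - (+ 1 + n)
  square-step false = step₊
  square-step true  = step₋

pronic : ℕ → ℕ
pronic w = w ℕ.* suc w

-- For n = 8K + 2 twice a coefficient of THR3 at U is 8(K + 1) + 4w(w + 1) modulo 16, where w = |U|.
private
  pair-identity : ∀ K w₁ w₂ → let n = + 8 * K + + 2; b₁ = n - + 2 * w₁; b₂ = n - + 2 * w₂ in
    ((+ 1 + b₁) * (+ 1 + b₁) + + 1 - n) + ((+ 1 + b₂) * (+ 1 + b₂) + + 1 - n)
      - + 4 * (w₁ * (+ 1 + w₁) + w₂ * (+ 1 + w₂))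
      ≡ + 16 * (+ 8 * K * K + + 5 * K + + 1 - + 2 * K * (w₁ + w₂) - (w₁ + w₂))
  pair-identity = solve-∀

  sixteen-∣ : ∀ {n p₁ p₂} K w₁ w₂ → n ≡ + 8 * K + + 2 → p₁ ≡ w₁ * (+ 1 + w₁) → p₂ ≡ w₂ * (+ 1 + w₂) →
    let b₁ = n - + 2 * w₁; b₂ = n - + 2 * w₂ in
    + 16 ∣ ((+ 1 + b₁) * (+ 1 + b₁) + + 1 - n) + ((+ 1 + b₂) * (+ 1 + b₂) + + 1 - n) - + 4 * (p₁ + p₂)
  sixteen-∣ K w₁ w₂ refl refl refl = subst (+ 16 ∣_) (sym (pair-identity K w₁ w₂)) (∣m⇒∣m*n _ (∣-refl {+ 16}))

THR3-coeff-pair-∣ : ∀ K (T T′ : Vec Bool (8 ℕ.* K ℕ.+ 2)) →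
  + 8 ∣ coeff (THR 3) T + coeff (THR 3) T′ → 4 ∣ℕ pronic (weight T) ℕ.+ pronic (weight T′)
THR3-coeff-pair-∣ K T T′ 8∣L = ∣⇒∣ᵤ (*-cancelˡ-∣ (+ 4) {+ 4} 16∣4P)
  where
  n = 8 ℕ.* K ℕ.+ 2
  L = coeff (THR 3) T + coeff (THR 3) T′
  P = + (pronic (weight T) ℕ.+ pronic (weight T′))
  twice-L : + 2 * L ≡ ((+ 1 + bias T) * (+ 1 + bias T) + + 1 - + n) + ((+ 1 + bias T′) * (+ 1 + bias T′) + + 1 - + n)
  twice-L = trans (ℤ.*-distribˡ-+ (+ 2) (coeff (THR 3) T) (coeff (THR 3) T′)) (cong₂ _+_ (twice-coeff-THR3 T) (twice-coeff-THR3 T′))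
  16∣2L : + 16 ∣ + 2 * L
  16∣2L = *-monoʳ-∣ (+ 2) 8∣L
  16∣2L-4P : + 16 ∣ + 2 * L - + 4 * P
  16∣2L-4P = subst (λ a → + 16 ∣ a - + 4 * P) (sym twice-L)
    (sixteen-∣ (+ K) (+ weight T) (+ weight T′) (trans (ℤ.pos-+ (8 ℕ.* K) 2) (cong (_+ + 2) (ℤ.pos-* 8 K)))
               (ℤ.pos-* (weight T) _) (ℤ.pos-* (weight T′) _))
  cancel : ∀ a b → a - (a - b) ≡ b
  cancel = solve-∀
  16∣4P : + 16 ∣ + 4 * P
  16∣4P = subst (+ 16 ∣_) (cancel (+ 2 * L) (+ 4 * P)) (∣m∣n⇒∣m-n 16∣2L 16∣2L-4P)

pronic-mod4 : ∀ w → pronic w % 4 ≡ pronic (w % 4) % 4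
pronic-mod4 w = begin
  pronic w % 4                  ≡⟨ cong (λ v → pronic v % 4) (m≡m%n+[m/n]*n w 4) ⟩
  pronic (r ℕ.+ q ℕ.* 4) % 4    ≡⟨ cong (_% 4) (expand r q) ⟩
  (pronic r ℕ.+ c ℕ.* 4) % 4    ≡⟨ [m+kn]%n≡m%n (pronic r) c 4 ⟩
  pronic r % 4                  ∎
  where
  r = w % 4
  q = w / 4
  c = q ℕ.* (2 ℕ.* r ℕ.+ 1) ℕ.+ 4 ℕ.* q ℕ.* q
  expand : ∀ r q → (r ℕ.+ q ℕ.* 4) ℕ.* (1 ℕ.+ (r ℕ.+ q ℕ.* 4))
                 ≡ r ℕ.* (1 ℕ.+ r) ℕ.+ (q ℕ.* (2 ℕ.* r ℕ.+ 1) ℕ.+ 4 ℕ.* q ℕ.* q) ℕ.* 4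
  expand = ℕ-Solver.solve-∀

pronic-pair-mod4 : ∀ a k s {r} → s % 4 ≡ r →
  (pronic a ℕ.+ pronic (k ℕ.+ s)) % 4 ≡ (pronic (a % 4) ℕ.+ pronic ((k % 4 ℕ.+ r) % 4)) % 4
pronic-pair-mod4 a k s refl = begin
  (pronic a ℕ.+ pronic (k ℕ.+ s)) % 4
    ≡⟨ %-distribˡ-+ (pronic a) (pronic (k ℕ.+ s)) 4 ⟩
  (pronic a % 4 ℕ.+ pronic (k ℕ.+ s) % 4) % 4
    ≡⟨ cong₂ (λ x y → (x ℕ.+ y) % 4) (pronic-mod4 a)
             (trans (pronic-mod4 (k ℕ.+ s)) (cong (λ r → pronic r % 4) (%-distribˡ-+ k s 4))) ⟩
  (pronic (a % 4) % 4 ℕ.+ pronic ((k % 4 ℕ.+ s % 4) % 4) % 4) % 4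
    ≡⟨ %-distribˡ-+ (pronic (a % 4)) _ 4 ⟨
  (pronic (a % 4) ℕ.+ pronic ((k % 4 ℕ.+ s % 4) % 4)) % 4 ∎

flip-one : ∀ {n} (S : Vec Bool n) {s} → weight S ≡ suc s → ∃[ T ] weight T ≡ 1 × weight (T ⊕ S) ≡ s
flip-one {suc n} (true ∷ S) eq =
  true ∷ zeros n , cong suc (weight-zeros n) , trans (cong weight (⊕-identityˡ S)) (ℕ.suc-injective eq)
flip-one (false ∷ S) eq with flip-one S eq
... | T , w₁ , w₂ = false ∷ T , w₁ , w₂

flip-zero : ∀ {n} (S : Vec Bool n) → weight S < n → ∃[ T ] weight T ≡ 1 × weight (T ⊕ S) ≡ suc (weight S)
flip-zero {suc n} (false ∷ S) _ = true ∷ zeros n , cong suc (weight-zeros n) , cong (suc ∘ weight) (⊕-identityˡ S)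
flip-zero (true ∷ S) (s≤s lt) with flip-zero S lt
... | T , w₁ , w₂ = false ∷ T , w₁ , cong suc w₂

Obstructs : ∀ {n} → Vec Bool n → Vec Bool n → Set
Obstructs T S = (pronic (weight T) ℕ.+ pronic (weight (T ⊕ S))) % 4 ≡ 2

obstructs-by-weights : ∀ {n} (T S : Vec Bool n) {a b} → weight T ≡ a → weight (T ⊕ S) ≡ b →
  (pronic a ℕ.+ pronic b) % 4 ≡ 2 → Obstructs T S
obstructs-by-weights T S refl refl p = p

obstructs⇒∤ : ∀ {n} {T S : Vec Bool n} → Obstructs T S → ¬ (4 ∣ℕ pronic (weight T) ℕ.+ pronic (weight (T ⊕ S)))
obstructs⇒∤ obs 4∣ with () ← trans (sym (n∣m⇒m%n≡0 _ 4 4∣)) obs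

-- Writing |S| = s + 1: take T = 0 if s ≡ 0, 1 (mod 4), a point of S if s ≡ 3, and a point
-- outside S if s ≡ 2, which exists because then |S| ≡ 3 ≢ n (mod 4).
obstruction : ∀ {n} → n % 4 ≢ 3 → (S : Vec Bool n) → weight S ≢ 0 → ∃[ T ] Obstructs T S
obstruction {n} n≢3 S w≢0 with weight S in eq
... | zero  = ⊥-elim (w≢0 refl)
... | suc s = by-residue (s % 4) refl (m%n<n s 4)
  where
  T-zero : (pronic 0 ℕ.+ pronic (suc s)) % 4 ≡ 2 → ∃[ T ] Obstructs T S
  T-zero p = zeros n , obstructs-by-weights (zeros n) S (weight-zeros n) (trans (cong weight (⊕-identityˡ S)) eq) p
  by-residue : ∀ r → s % 4 ≡ r → r < 4 → ∃[ T ] Obstructs T S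
  by-residue 0 s≡ _ = T-zero (pronic-pair-mod4 0 1 s s≡)
  by-residue 1 s≡ _ = T-zero (pronic-pair-mod4 0 1 s s≡)
  by-residue 2 s≡ _ with ℕ.m≤n⇒m<n∨m≡n (weight-≤ S)
  ... | inj₂ full = ⊥-elim (n≢3 (begin
    n % 4                 ≡⟨ cong (_% 4) (trans (sym full) eq) ⟩
    suc s % 4             ≡⟨ %-distribˡ-+ 1 s 4 ⟩
    (1 ℕ.+ s % 4) % 4     ≡⟨ cong (λ r → (1 ℕ.+ r) % 4) s≡ ⟩
    3                     ∎))
  ... | inj₁ lt with flip-zero S lt
  ...   | T , w₁ , w₂ = T , obstructs-by-weights T S w₁ (trans w₂ (cong suc eq)) (pronic-pair-mod4 1 2 s s≡)
  by-residue 3 s≡ _ with flip-one S eq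
  ... | T , w₁ , w₂ = T , obstructs-by-weights T S w₁ w₂ (pronic-pair-mod4 1 0 s s≡)
  by-residue (suc (suc (suc (suc _)))) _ (s≤s (s≤s (s≤s (s≤s ()))))

-- Lower bound

8*K+2≡K*2*4+2 : ∀ K → 8 ℕ.* K ℕ.+ 2 ≡ K ℕ.* 2 ℕ.* 4 ℕ.+ 2
8*K+2≡K*2*4+2 = ℕ-Solver.solve-∀

leaf-not-THR3 : ∀ {n} → 3 ≤ n → ∀ s → ¬ Computes (leaf s) (THR3 n)
leaf-not-THR3 {n} 3≤n s c with c (zeros n) | c (replicate n true)
... | s≡+1 | s≡-1 rewrite weight-zeros n | weight-ones n | Equivalence.to T-≡ (ℕ.≤⇒≤ᵇ 3≤n)
  with () ← trans (sym s≡+1) s≡-1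

node-computes₀ : ∀ {n} {S : Vec Bool n} {t₀ t₁ f} → Computes (node S t₀ t₁) f →
  ∀ x → parity S x ≡ false → eval t₀ x ≡ f x
node-computes₀ {t₀ = t₀} {t₁} c x p = trans (cong (λ b → if b then eval t₁ x else eval t₀ x) (sym p)) (c x)

node-depth₀ : ∀ {n m} {S : Vec Bool n} {t₀ t₁} → suc (depth (node S t₀ t₁)) < m → 3 ℕ.+ depth t₀ ≤ m
node-depth₀ {t₀ = t₀} {t₁} h = ℕ.≤-trans (ℕ.+-monoʳ-≤ 3 (ℕ.m≤m⊔n (depth t₀) (depth t₁))) h

module _ (k : ℕ) where
  private
    n = 8 ℕ.* suc k ℕ.+ 2

    3≤n : 3 ≤ n
    3≤n = ℕ.+-monoˡ-≤ 2 (s≤s z≤n)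

    n%4≢3 : n % 4 ≢ 3
    n%4≢3 eq with () ← trans (sym eq)
      (trans (cong (_% 4) (8*K+2≡K*2*4+2 (suc k))) (%-remove-+ˡ 2 {4} (n∣m*n (suc k ℕ.* 2))))

  THR3-tree-not-shallow : (t : PDT n) → Computes t (THR3 n) → ¬ (suc (depth t) < n)
  THR3-tree-not-shallow (leaf s) c _ = leaf-not-THR3 3≤n s c
  THR3-tree-not-shallow (node S t₀ t₁) c h with weight S ℕ.≟ 0
  ... | yes w≡0 = THR3-tree-not-shallow t₀ (λ x → node-computes₀ {S = S} {t₀} {t₁} c x (S≡0 x)) (ℕ.≤-trans (ℕ.n≤1+n _) (node-depth₀ {S = S} {t₀} {t₁} h))
    where
    S≡0 : ∀ x → parity S x ≡ false
    S≡0 x = trans (cong (λ U → parity U x) (weight≡0⇒zeros S w≡0)) (parity-zeros x)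
  ... | no w≢0 with obstruction n%4≢3 S w≢0
  ...   | T , obs = obstructs⇒∤ {T = T} {S} obs (THR3-coeff-pair-∣ (suc k) T (T ⊕ S) 8∣coeffs)
    where
    d₀+3≤n : depth t₀ ℕ.+ 3 ≤ n
    d₀+3≤n = subst (_≤ n) (ℕ.+-comm 3 (depth t₀)) (node-depth₀ {S = S} {t₀} {t₁} h)
    -- t₀ agrees with THR3 wherever ⊕_S x = 0, and these are the only points the pair T, T ⊕ S sees.
    8∣coeffs : + 8 ∣ coeff (THR 3) T + coeff (THR 3) (T ⊕ S)
    8∣coeffs = subst (+ 8 ∣_) (coeff-pair-cong S (node-computes₀ {S = S} {t₀} {t₁} c) T)
                     (∣m∣n⇒∣m+n (granularity t₀ d₀+3≤n T) (granularity t₀ d₀+3≤n (T ⊕ S)))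

-- Upper bound

weaken : ∀ {m} → PDT m → PDT (suc m)
weaken (leaf s)       = leaf s
weaken (node S t₀ t₁) = node (false ∷ S) (weaken t₀) (weaken t₁)

eval-weaken : ∀ {m} (t : PDT m) b x → eval (weaken t) (b ∷ x) ≡ eval t x
eval-weaken (leaf s)       b x = refl
eval-weaken (node S t₀ t₁) b x rewrite eval-weaken t₀ b x | eval-weaken t₁ b x = refl

depth-weaken : ∀ {m} (t : PDT m) → depth (weaken t) ≡ depth t
depth-weaken (leaf s)       = refl
depth-weaken (node S t₀ t₁) = cong₂ (λ d₀ d₁ → suc (d₀ ℕ.⊔ d₁)) (depth-weaken t₀) (depth-weaken t₁)

weakenⁿ : ∀ k {m} → PDT m → PDT (k ℕ.+ m)
weakenⁿ zero    t = t
weakenⁿ (suc k) t = weaken (weakenⁿ k t)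

eval-weakenⁿ : ∀ {k m} (t : PDT m) (xs : Vec Bool k) y → eval (weakenⁿ k t) (xs ++ y) ≡ eval t y
eval-weakenⁿ         t []       y = refl
eval-weakenⁿ {suc k} t (b ∷ xs) y = trans (eval-weaken (weakenⁿ k t) b (xs ++ y)) (eval-weakenⁿ t xs y)

depth-weakenⁿ : ∀ k {m} (t : PDT m) → depth (weakenⁿ k t) ≡ depth t
depth-weakenⁿ zero    t = refl
depth-weakenⁿ (suc k) t = trans (depth-weaken (weakenⁿ k t)) (depth-weakenⁿ k t)

depth-weakenⁿ-≤ : ∀ k {m d} (t : PDT m) → depth t ≤ d → depth (weakenⁿ k t) ≤ d
depth-weakenⁿ-≤ k t = subst (_≤ _) (sym (depth-weakenⁿ k t))

queryAll : ∀ {m} → (Input m → Sign) → PDT m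
queryAll {zero}  f = leaf (f [])
queryAll {suc m} f = node (true ∷ zeros m) (weaken (queryAll (λ x → f (false ∷ x)))) (weaken (queryAll (λ x → f (true ∷ x))))

queryAll-correct : ∀ {m} (f : Input m → Sign) → Computes (queryAll f) f
queryAll-correct {zero}  f [] = refl
queryAll-correct {suc m} f (b ∷ x) rewrite parity-zeros x with b
... | false = trans (eval-weaken (queryAll (λ x → f (false ∷ x))) false x) (queryAll-correct (λ x → f (false ∷ x)) x)
... | true  = trans (eval-weaken (queryAll (λ x → f (true ∷ x))) true x) (queryAll-correct (λ x → f (true ∷ x)) x)

queryAll-depth : ∀ {m} (f : Input m → Sign) → depth (queryAll f) ≤ m
queryAll-depth {zero}  f = z≤n
queryAll-depth {suc m} f = s≤s (ℕ.⊔-lub (bound (λ x → f (false ∷ x))) (bound (λ x → f (true ∷ x))))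
  where
  bound : (g : Input m → Sign) → depth (weaken (queryAll g)) ≤ m
  bound g = depth-weakenⁿ-≤ 1 (queryAll g) (queryAll-depth g)

module _ {m : ℕ} where
  private
    query : Bool → Bool → Bool → Bool → Vec Bool (4 ℕ.+ m)
    query a b c d = a ∷ b ∷ c ∷ d ∷ zeros m

  -- If x₁ ⊕ x₂ = 1, then THR3 x = THR 2 (x₃ …). Otherwise x₁ = x₂, and if x₃ ⊕ x₄ = 1 the first four
  -- bits have weight 2x₁ + 1; else, if x₁ ⊕ x₃ = 1 they have weight 2, and if not all four equal x₁.
  extend : PDT m → PDT m → PDT m → PDT (2 ℕ.+ m) → PDT (4 ℕ.+ m)
  extend t r₁ r₂ r₂′ =
    node (query true true false false)
      (node (query false false true true)
        (node (query true false true false)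
          (node (query true false false false) (weakenⁿ 4 t) (leaf -1ₛ))
          (weakenⁿ 4 r₁))
        (node (query true false false false) (weakenⁿ 4 r₂) (leaf -1ₛ)))
      (weakenⁿ 2 r₂′)

  extend-correct : ∀ {t r₁ r₂ r₂′} →
    Computes t (THR3 m) → Computes r₁ (THR 1) → Computes r₂ (THR 2) → Computes r₂′ (THR 2) →
    Computes (extend t r₁ r₂ r₂′) (THR3 (4 ℕ.+ m))
  extend-correct {t = t} {r₁} {r₂} {r₂′} t-ok r₁-ok r₂-ok r₂′-ok (a ∷ b ∷ c ∷ d ∷ y)
    rewrite parity-zeros y
          | eval-weakenⁿ t   (a ∷ b ∷ c ∷ d ∷ []) y
          | eval-weakenⁿ r₁  (a ∷ b ∷ c ∷ d ∷ []) y
          | eval-weakenⁿ r₂  (a ∷ b ∷ c ∷ d ∷ []) y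
          | eval-weakenⁿ r₂′ (a ∷ b ∷ []) (c ∷ d ∷ y)
          | t-ok y | r₁-ok y | r₂-ok y | r₂′-ok (c ∷ d ∷ y)
    with a | b | c | d
  ... | false | false | false | false = refl
  ... | false | false | false | true  = refl
  ... | false | false | true  | false = refl
  ... | false | false | true  | true  = refl
  ... | false | true  | _     | _     = refl
  ... | true  | false | _     | _     = refl
  ... | true  | true  | false | false = refl
  ... | true  | true  | false | true  = refl
  ... | true  | true  | true  | false = refl
  ... | true  | true  | true  | true  = refl

  extend-depth : ∀ {t r₁ r₂ r₂′} → depth t < m → depth r₁ ≤ m → depth r₂ ≤ m → depth r₂′ ≤ 2 ℕ.+ m →
    depth (extend t r₁ r₂ r₂′) < 4 ℕ.+ m
  extend-depth {t = t} {r₁} {r₂} {r₂′} t< r₁≤ r₂≤ r₂′≤ =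
    s≤s (s≤s (ℕ.⊔-lub
      (s≤s (ℕ.⊔-lub (s≤s (ℕ.⊔-lub t-branch≤ (depth-weakenⁿ-≤ 4 r₁ r₁≤)))
                    (s≤s (ℕ.⊔-lub (depth-weakenⁿ-≤ 4 r₂ r₂≤) z≤n))))
      (depth-weakenⁿ-≤ 2 r₂′ r₂′≤)))
    where
    t-branch≤ : suc (depth (weakenⁿ 4 t) ℕ.⊔ 0) ≤ m
    t-branch≤ = subst (λ d → suc d ≤ m) (sym (trans (ℕ.⊔-identityʳ _) (depth-weakenⁿ 4 t))) t<

THR3-tree-below : ∀ j → ∃[ t ] Computes t (THR3 (j ℕ.* 4 ℕ.+ 2)) × depth t < j ℕ.* 4 ℕ.+ 2
THR3-tree-below zero = leaf +1ₛ , constant , s≤s z≤n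
  where
  constant : Computes (leaf +1ₛ) (THR3 2)
  constant (false ∷ false ∷ []) = refl
  constant (false ∷ true  ∷ []) = refl
  constant (true  ∷ false ∷ []) = refl
  constant (true  ∷ true  ∷ []) = refl
THR3-tree-below (suc j) with THR3-tree-below j
... | t , t-ok , t< =
  extend t r₁ r₂ r₂′ ,
  extend-correct {t = t} {r₁} {r₂} {r₂′} t-ok (queryAll-correct (THR 1)) (queryAll-correct (THR 2)) (queryAll-correct (THR 2)) ,
  extend-depth {t = t} {r₁} {r₂} {r₂′} t< (queryAll-depth (THR 1)) (queryAll-depth (THR 2)) (queryAll-depth (THR 2))
  where
  m = j ℕ.* 4 ℕ.+ 2
  r₁ r₂ : PDT m
  r₁ = queryAll (THR 1)
  r₂ = queryAll (THR 2)
  r₂′ : PDT (2 ℕ.+ m)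
  r₂′ = queryAll (THR 2)

theorem17 : ∀ (k : ℕ) → let n = 8 ℕ.* suc k ℕ.+ 2 in ParityDTDepthIs (THR3 n) (n ℕ.∸ 1)
theorem17 k with subst (λ m → ∃[ t ] Computes t (THR3 m) × depth t < m) (sym (8*K+2≡K*2*4+2 (suc k)))
                       (THR3-tree-below (suc k ℕ.* 2))
... | t , t-ok , t<n = (t , t-ok , ℕ.≤-antisym (ℕ.∸-monoˡ-≤ 1 t<n) (lower t t-ok)) , lower
  where
  lower : ∀ t → Computes t (THR3 (8 ℕ.* suc k ℕ.+ 2)) → 8 ℕ.* suc k ℕ.+ 2 ℕ.∸ 1 ≤ depth t
  lower t c = ℕ.∸-monoˡ-≤ 1 (ℕ.≮⇒≥ (THR3-tree-not-shallow k t c))
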